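{- The theory $\mathsf{I}(\ne) + \forall x \forall y (x + y = y + x)$ proves associativity of addition, commutativity and associativity of multiplication, and left and right distributivity: $x + (y+z) = (x+y)+z$, $xy = yx$, $x(yz) = (xy)z$, $x(y+z) = xy + xz$, $(x+y)z = xz + yz$ (universally closed).
   Context: The language is $\mathcal L_{ar} = (0, S, +, \cdot, \leqslant)$. Robinson arithmetic $\mathsf Q$ consists of the (universal closures of the) axioms: $Sx \ne 0$; $Sx = Sy \rightarrow x = y$; $x \ne 0 \rightarrow \exists y (x = Sy)$; $x + 0 = x$; $x + Sy = S(x+y)$; $x \cdot 0 = 0$; $x \cdot Sy = x\cdot y + x$; $x \leqslant y \leftrightarrow \exists r (r + x = y)$. $\mathsf I(\ne)$ is $\mathsf Q$ plus the induction axioms (universal closures of $\varphi(0,\vec y) \wedge \forall x(\varphi(x,\vec y)\rightarrow \varphi(Sx,\vec y)) \rightarrow \forall x\, \varphi(x,\vec y)$) for all formulas $\varphi$ of the form $t \ne s$ with $t,s$ terms. -}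

module Defs where

open import Data.Nat using (ℕ) renaming (zero to nz; suc to ns)
open import Data.List using (List; []; _∷_; map)
open import Data.List.Membership.Propositional using (_∈_)
open import Data.Product using (_×_)

infixl 7 _·'_
infixl 6 _+'_
infix  5 _≐_ _≤'_
infixr 4 _∧'_
infixr 3 _∨'_
infixr 2 _⇒_ _⇔_

data Term : Set where
  var   : ℕ → Term
  zero' : Term
  S'    : Term → Term
  _+'_  : Term → Term → Term
  _·'_  : Term → Term → Term

data Formula : Set where
  _≐_  : Term → Term → Formula
  _≤'_ : Term → Term → Formula
  ⊥'   : Formula
  _⇒_  : Formula → Formula → Formula
  _∧'_ : Formula → Formula → Formula
  _∨'_ : Formula → Formula → Formula
  ∀'   : Formula → Formula
  ∃'   : Formula → Formula

¬' : Formula → Formula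
¬' φ = φ ⇒ ⊥'

_⇔_ : Formula → Formula → Formula
φ ⇔ ψ = (φ ⇒ ψ) ∧' (ψ ⇒ φ)

∀ⁿ : ℕ → Formula → Formula
∀ⁿ nz     φ = φ
∀ⁿ (ns n) φ = ∀' (∀ⁿ n φ)

Subst : Set
Subst = ℕ → Term

substT : Subst → Term → Term
substT σ (var i)  = σ i
substT σ zero'    = zero'
substT σ (S' t)   = S' (substT σ t)
substT σ (t +' u) = substT σ t +' substT σ u
substT σ (t ·' u) = substT σ t ·' substT σ u

shiftT : Term → Term
shiftT = substT (λ i → var (ns i))

lift : Subst → Subst
lift σ nz     = var nz
lift σ (ns i) = shiftT (σ i)

substF : Subst → Formula → Formula
substF σ (t ≐ u)  = substT σ t ≐ substT σ u
substF σ (t ≤' u) = substT σ t ≤' substT σ u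
substF σ ⊥'       = ⊥'
substF σ (φ ⇒ ψ)  = substF σ φ ⇒ substF σ ψ
substF σ (φ ∧' ψ) = substF σ φ ∧' substF σ ψ
substF σ (φ ∨' ψ) = substF σ φ ∨' substF σ ψ
substF σ (∀' φ)   = ∀' (substF (lift σ) φ)
substF σ (∃' φ)   = ∃' (substF (lift σ) φ)

shiftF : Formula → Formula
shiftF = substF (λ i → var (ns i))

single : Term → Subst
single t nz     = t
single t (ns i) = var i

_[_] : Formula → Term → Formula
φ [ t ] = substF (single t) φ

Theory : Set₁
Theory = Formula → Set

data _⨾_⊢_ (T : Theory) : List Formula → Formula → Set where
  hyp  : ∀ {Γ φ} → φ ∈ Γ → T ⨾ Γ ⊢ φ
  ax   : ∀ {Γ φ} → T φ → T ⨾ Γ ⊢ φ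
  ⇒I   : ∀ {Γ φ ψ} → T ⨾ (φ ∷ Γ) ⊢ ψ → T ⨾ Γ ⊢ (φ ⇒ ψ)
  ⇒E   : ∀ {Γ φ ψ} → T ⨾ Γ ⊢ (φ ⇒ ψ) → T ⨾ Γ ⊢ φ → T ⨾ Γ ⊢ ψ
  ∧I   : ∀ {Γ φ ψ} → T ⨾ Γ ⊢ φ → T ⨾ Γ ⊢ ψ → T ⨾ Γ ⊢ (φ ∧' ψ)
  ∧E₁  : ∀ {Γ φ ψ} → T ⨾ Γ ⊢ (φ ∧' ψ) → T ⨾ Γ ⊢ φ
  ∧E₂  : ∀ {Γ φ ψ} → T ⨾ Γ ⊢ (φ ∧' ψ) → T ⨾ Γ ⊢ ψ
  ∨I₁  : ∀ {Γ φ ψ} → T ⨾ Γ ⊢ φ → T ⨾ Γ ⊢ (φ ∨' ψ)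
  ∨I₂  : ∀ {Γ φ ψ} → T ⨾ Γ ⊢ ψ → T ⨾ Γ ⊢ (φ ∨' ψ)
  ∨E   : ∀ {Γ φ ψ χ} → T ⨾ Γ ⊢ (φ ∨' ψ) → T ⨾ (φ ∷ Γ) ⊢ χ → T ⨾ (ψ ∷ Γ) ⊢ χ → T ⨾ Γ ⊢ χ
  ⊥E   : ∀ {Γ φ} → T ⨾ Γ ⊢ ⊥' → T ⨾ Γ ⊢ φ
  raa  : ∀ {Γ φ} → T ⨾ (¬' φ ∷ Γ) ⊢ ⊥' → T ⨾ Γ ⊢ φ
  ∀I   : ∀ {Γ φ} → T ⨾ map shiftF Γ ⊢ φ → T ⨾ Γ ⊢ ∀' φ
  ∀E   : ∀ {Γ φ} → T ⨾ Γ ⊢ ∀' φ → (t : Term) → T ⨾ Γ ⊢ (φ [ t ])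
  ∃I   : ∀ {Γ φ} (t : Term) → T ⨾ Γ ⊢ (φ [ t ]) → T ⨾ Γ ⊢ ∃' φ
  ∃E   : ∀ {Γ φ ψ} → T ⨾ Γ ⊢ ∃' φ → T ⨾ (φ ∷ map shiftF Γ) ⊢ shiftF ψ → T ⨾ Γ ⊢ ψ
  ≐refl : ∀ {Γ} (t : Term) → T ⨾ Γ ⊢ (t ≐ t)
  ≐subst : ∀ {Γ} (φ : Formula) {s t : Term} → T ⨾ Γ ⊢ (s ≐ t) → T ⨾ Γ ⊢ (φ [ s ]) → T ⨾ Γ ⊢ (φ [ t ])

v0 v1 v2 : Term
v0 = var 0
v1 = var 1
v2 = var 2

-- Induction instance for φ (variable 0 = induction variable x,
-- variables 1,2,... = parameters, which become 0,1,... outside).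
indAx : Formula → Formula
indAx φ =
  (substF (single zero') φ ∧'
   ∀' (φ ⇒ substF (λ { nz → S' v0 ; (ns i) → var (ns i) }) φ))
  ⇒ ∀' φ

data I≠+comm : Theory where
  Q1 : I≠+comm (∀' (¬' (S' v0 ≐ zero')))
  Q2 : I≠+comm (∀' (∀' (S' v1 ≐ S' v0 ⇒ v1 ≐ v0)))
  Q3 : I≠+comm (∀' (¬' (v0 ≐ zero') ⇒ ∃' (v1 ≐ S' v0)))
  Q4 : I≠+comm (∀' (v0 +' zero' ≐ v0))
  Q5 : I≠+comm (∀' (∀' (v1 +' S' v0 ≐ S' (v1 +' v0))))
  Q6 : I≠+comm (∀' (v0 ·' zero' ≐ zero'))
  Q7 : I≠+comm (∀' (∀' (v1 ·' S' v0 ≐ v1 ·' v0 +' v1)))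
  Q8 : I≠+comm (∀' (∀' (v1 ≤' v0 ⇔ ∃' (v0 +' v2 ≐ v1))))
  -- induction for t ≠ s, closed by n universal quantifiers
  -- (n ≥ number of parameters gives the universal closure)
  Ind  : (n : ℕ) (t s : Term) → I≠+comm (∀ⁿ n (indAx (¬' (t ≐ s))))
  Comm : I≠+comm (∀' (∀' (v1 +' v0 ≐ v0 +' v1)))

_⊢₀_ : Theory → Formula → Set
T ⊢₀ φ = T ⨾ [] ⊢ φ

{-# OPTIONS --safe #-}
module Submission where

-- To prove t(a) = s(a), consider the equation E(x) :≡ t(x) + s(a) = s(x) + t(a), whose negation
-- is a disequation of terms and so admits induction. E(a) holds by commutativity of +. When t(Sx)
-- and s(Sx) arise from t(x) and s(x) by adding the same successor or the same summand,
-- cancellation gives E(Sx) → E(x); then ≠-induction, read contrapositively, carries E from a down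
-- to 0. Cancelling t(0) = s(0) in E(0) gives t(a) = s(a). Left cancellation itself is obtained by
-- the same descent on x + a = x + b.

open import Defs
open import Data.Product using (_×_; _,_)
open import Data.Nat using () renaming (zero to nz; suc to ns)
open import Data.List using (List; _∷_)
open import Data.List.Relation.Unary.Any using (here; there)
open import Level using (0ℓ)
open import Relation.Binary.Bundles using (Setoid)
open import Relation.Binary.PropositionalEquality using (_≡_; refl; sym; trans; cong; cong₂)
import Relation.Binary.Reasoning.Setoid as SetoidReasoning

infix 1 _⊩_
_⊩_ : List Formula → Formula → Set
Γ ⊩ φ = I≠+comm ⨾ Γ ⊢ φ

substT-ext : ∀ {σ τ} → (∀ i → σ i ≡ τ i) → ∀ t → substT σ t ≡ substT τ t
substT-ext e (var i)  = e i
substT-ext e zero'    = refl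
substT-ext e (S' t)   = cong S' (substT-ext e t)
substT-ext e (t +' u) = cong₂ _+'_ (substT-ext e t) (substT-ext e u)
substT-ext e (t ·' u) = cong₂ _·'_ (substT-ext e t) (substT-ext e u)

substT-id : ∀ t → substT var t ≡ t
substT-id (var i)  = refl
substT-id zero'    = refl
substT-id (S' t)   = cong S' (substT-id t)
substT-id (t +' u) = cong₂ _+'_ (substT-id t) (substT-id u)
substT-id (t ·' u) = cong₂ _·'_ (substT-id t) (substT-id u)

substT-comp : ∀ σ τ t → substT σ (substT τ t) ≡ substT (λ i → substT σ (τ i)) t
substT-comp σ τ (var i)  = refl
substT-comp σ τ zero'    = refl
substT-comp σ τ (S' t)   = cong S' (substT-comp σ τ t)
substT-comp σ τ (t +' u) = cong₂ _+'_ (substT-comp σ τ t) (substT-comp σ τ u)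
substT-comp σ τ (t ·' u) = cong₂ _·'_ (substT-comp σ τ t) (substT-comp σ τ u)

substT-∘ : ∀ {σ τ} υ → (∀ i → substT σ (τ i) ≡ υ i) → ∀ t → substT σ (substT τ t) ≡ substT υ t
substT-∘ {σ} {τ} υ e t = trans (substT-comp σ τ t) (substT-ext e t)

substT-∘-id : ∀ {σ τ} → (∀ i → substT σ (τ i) ≡ var i) → ∀ t → substT σ (substT τ t) ≡ t
substT-∘-id e t = trans (substT-∘ var e t) (substT-id t)

single-shiftT : ∀ u t → substT (single u) (shiftT t) ≡ t
single-shiftT u = substT-∘-id (λ i → refl)

lift-ext : ∀ {σ τ} → (∀ i → σ i ≡ τ i) → ∀ i → lift σ i ≡ lift τ i
lift-ext e nz     = refl
lift-ext e (ns i) = cong shiftT (e i)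

substF-ext : ∀ {σ τ} → (∀ i → σ i ≡ τ i) → ∀ φ → substF σ φ ≡ substF τ φ
substF-ext e (t ≐ u)  = cong₂ _≐_ (substT-ext e t) (substT-ext e u)
substF-ext e (t ≤' u) = cong₂ _≤'_ (substT-ext e t) (substT-ext e u)
substF-ext e ⊥'       = refl
substF-ext e (φ ⇒ ψ)  = cong₂ _⇒_ (substF-ext e φ) (substF-ext e ψ)
substF-ext e (φ ∧' ψ) = cong₂ _∧'_ (substF-ext e φ) (substF-ext e ψ)
substF-ext e (φ ∨' ψ) = cong₂ _∨'_ (substF-ext e φ) (substF-ext e ψ)
substF-ext e (∀' φ)   = cong ∀' (substF-ext (lift-ext e) φ)
substF-ext e (∃' φ)   = cong ∃' (substF-ext (lift-ext e) φ)

lift-comp : ∀ σ τ i → substT (lift σ) (lift τ i) ≡ lift (λ j → substT σ (τ j)) i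
lift-comp σ τ nz     = refl
lift-comp σ τ (ns i) = trans (substT-comp (lift σ) (λ j → var (ns j)) (τ i))
                             (sym (substT-comp (λ j → var (ns j)) σ (τ i)))

substF-comp : ∀ σ τ φ → substF σ (substF τ φ) ≡ substF (λ i → substT σ (τ i)) φ
substF-comp σ τ (t ≐ u)  = cong₂ _≐_ (substT-comp σ τ t) (substT-comp σ τ u)
substF-comp σ τ (t ≤' u) = cong₂ _≤'_ (substT-comp σ τ t) (substT-comp σ τ u)
substF-comp σ τ ⊥'       = refl
substF-comp σ τ (φ ⇒ ψ)  = cong₂ _⇒_ (substF-comp σ τ φ) (substF-comp σ τ ψ)
substF-comp σ τ (φ ∧' ψ) = cong₂ _∧'_ (substF-comp σ τ φ) (substF-comp σ τ ψ)
substF-comp σ τ (φ ∨' ψ) = cong₂ _∨'_ (substF-comp σ τ φ) (substF-comp σ τ ψ)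
substF-comp σ τ (∀' φ)   = cong ∀' (trans (substF-comp (lift σ) (lift τ) φ) (substF-ext (lift-comp σ τ) φ))
substF-comp σ τ (∃' φ)   = cong ∃' (trans (substF-comp (lift σ) (lift τ) φ) (substF-ext (lift-comp σ τ) φ))

substF-∘ : ∀ {σ τ} υ → (∀ i → substT σ (τ i) ≡ υ i) → ∀ φ → substF σ (substF τ φ) ≡ substF υ φ
substF-∘ {σ} {τ} υ e φ = trans (substF-comp σ τ φ) (substF-ext e φ)

infixr 5 _∷ₛ_
_∷ₛ_ : Term → Subst → Subst
(u ∷ₛ σ) nz     = u
(u ∷ₛ σ) (ns i) = σ i

-- t ⟨ u ⟩ substitutes u for variable 0 and, unlike _[_], leaves the other variables in place.
set₀ : Term → Subst
set₀ u nz     = u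
set₀ u (ns i) = var (ns i)

_⟨_⟩ : Term → Term → Term
t ⟨ u ⟩ = substT (set₀ u) t

shiftT₁ : Term → Term
shiftT₁ = substT (lift (λ i → var (ns i)))

single-shiftT₁ : ∀ u t → substT (single u) (shiftT₁ t) ≡ t ⟨ u ⟩
single-shiftT₁ u = substT-∘ (set₀ u) (λ { nz → refl ; (ns i) → refl })

single-v0-shiftT₁ : ∀ t → substT (single v0) (shiftT₁ t) ≡ t
single-v0-shiftT₁ = substT-∘-id (λ { nz → refl ; (ns i) → refl })

set₀-shiftT₁ : ∀ u t → substT (set₀ (shiftT₁ u)) (shiftT₁ t) ≡ shiftT₁ (t ⟨ u ⟩)
set₀-shiftT₁ u t = trans (substT-∘ υ (λ { nz → refl ; (ns i) → refl }) t)
                         (sym (substT-∘ υ (λ { nz → refl ; (ns i) → refl }) t))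
  where
  υ : Subst
  υ = shiftT₁ u ∷ₛ λ i → var (ns (ns i))

set₀-shiftT : ∀ u t → substT (set₀ u) (shiftT t) ≡ shiftT t
set₀-shiftT u = substT-∘ (λ i → var (ns i)) (λ i → refl)

cast : ∀ {Γ φ ψ} → φ ≡ ψ → Γ ⊩ φ → Γ ⊩ ψ
cast refl d = d

∀E-lift : ∀ {Γ σ φ} → Γ ⊩ ∀' (substF (lift σ) φ) → ∀ u → Γ ⊩ substF (u ∷ₛ σ) φ
∀E-lift {σ = σ} {φ} d u = cast (substF-∘ (u ∷ₛ σ) single-lift φ) (∀E d u)
  where
  single-lift : ∀ i → substT (single u) (lift σ i) ≡ (u ∷ₛ σ) i
  single-lift nz     = refl
  single-lift (ns i) = single-shiftT u (σ i)

∀E₂ : ∀ {Γ φ} → Γ ⊩ ∀' (∀' φ) → ∀ a b → Γ ⊩ substF (b ∷ₛ single a) φ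
∀E₂ d a b = ∀E-lift (∀E d a) b

∀E₃ : ∀ {Γ φ} → Γ ⊩ ∀' (∀' (∀' φ)) → ∀ a b c → Γ ⊩ substF (c ∷ₛ b ∷ₛ single a) φ
∀E₃ d a b c = ∀E-lift (∀E₂ d a b) c

≐-cong : ∀ {Γ a b} (t : Term) → Γ ⊩ a ≐ b → Γ ⊩ substT (single a) t ≐ substT (single b) t
≐-cong {a = a} {b} t h =
  cast (cong (_≐ substT (single b) t) (single-shiftT b t[a]))
       (≐subst (shiftT t[a] ≐ t) h (cast (cong (_≐ t[a]) (sym (single-shiftT a t[a]))) (≐refl t[a])))
  where t[a] = substT (single a) t

≐-sym : ∀ {Γ a b} → Γ ⊩ a ≐ b → Γ ⊩ b ≐ a
≐-sym {a = a} {b} h = cast (cong (b ≐_) (single-shiftT b a))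
  (≐subst (v0 ≐ shiftT a) h (cast (cong (a ≐_) (sym (single-shiftT a a))) (≐refl a)))

≐-trans : ∀ {Γ a b c} → Γ ⊩ a ≐ b → Γ ⊩ b ≐ c → Γ ⊩ a ≐ c
≐-trans {a = a} {b} {c} h₁ h₂ = cast (cong (_≐ c) (single-shiftT c a))
  (≐subst (shiftT a ≐ v0) h₂ (cast (cong (_≐ b) (sym (single-shiftT b a))) h₁))

≐-setoid : List Formula → Setoid 0ℓ 0ℓ
≐-setoid Γ = record
  { Carrier       = Term
  ; _≈_           = λ a b → Γ ⊩ a ≐ b
  ; isEquivalence = record { refl = ≐refl _ ; sym = ≐-sym ; trans = ≐-trans }
  }

module ≐-Reasoning {Γ : List Formula} where
  open SetoidReasoning (≐-setoid Γ) public

S-cong : ∀ {Γ a b} → Γ ⊩ a ≐ b → Γ ⊩ S' a ≐ S' b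
S-cong = ≐-cong (S' v0)

+-congʳ : ∀ {Γ a b} c → Γ ⊩ a ≐ b → Γ ⊩ a +' c ≐ b +' c
+-congʳ {a = a} {b} c h =
  cast (cong₂ (λ u v → a +' u ≐ b +' v) (single-shiftT a c) (single-shiftT b c)) (≐-cong (v0 +' shiftT c) h)

+-congˡ : ∀ {Γ a b} c → Γ ⊩ a ≐ b → Γ ⊩ c +' a ≐ c +' b
+-congˡ {a = a} {b} c h =
  cast (cong₂ (λ u v → u +' a ≐ v +' b) (single-shiftT a c) (single-shiftT b c)) (≐-cong (shiftT c +' v0) h)

·-congˡ : ∀ {Γ a b} c → Γ ⊩ a ≐ b → Γ ⊩ c ·' a ≐ c ·' b
·-congˡ {a = a} {b} c h =
  cast (cong₂ (λ u v → u ·' a ≐ v ·' b) (single-shiftT a c) (single-shiftT b c)) (≐-cong (shiftT c ·' v0) h)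

+-cong : ∀ {Γ a b c d} → Γ ⊩ a ≐ b → Γ ⊩ c ≐ d → Γ ⊩ a +' c ≐ b +' d
+-cong {b = b} {c} h₁ h₂ = ≐-trans (+-congʳ c h₁) (+-congˡ b h₂)

S-injective : ∀ {Γ a b} → Γ ⊩ S' a ≐ S' b → Γ ⊩ a ≐ b
S-injective {a = a} {b} = ⇒E (∀E₂ (ax Q2) a b)

+-identityʳ : ∀ {Γ} a → Γ ⊩ a +' zero' ≐ a
+-identityʳ = ∀E (ax Q4)

+-sucʳ : ∀ {Γ} a b → Γ ⊩ a +' S' b ≐ S' (a +' b)
+-sucʳ = ∀E₂ (ax Q5)

·-zeroʳ : ∀ {Γ} a → Γ ⊩ a ·' zero' ≐ zero'
·-zeroʳ = ∀E (ax Q6)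

·-sucʳ : ∀ {Γ} a b → Γ ⊩ a ·' S' b ≐ a ·' b +' a
·-sucʳ = ∀E₂ (ax Q7)

+-comm : ∀ {Γ} a b → Γ ⊩ a +' b ≐ b +' a
+-comm = ∀E₂ (ax Comm)

+-identityˡ : ∀ {Γ} a → Γ ⊩ zero' +' a ≐ a
+-identityˡ a = ≐-trans (+-comm zero' a) (+-identityʳ a)

+-sucˡ : ∀ {Γ} a b → Γ ⊩ S' a +' b ≐ S' (a +' b)
+-sucˡ a b = ≐-trans (+-comm (S' a) b) (≐-trans (+-sucʳ b a) (S-cong (+-comm b a)))

descend-to-zero : ∀ {Γ} (φ : Formula)
  → (∀ {Δ} → Δ ⊩ indAx (¬' φ))
  → (∀ {Δ} → Δ ⊩ substF (set₀ (S' v0)) φ → Δ ⊩ φ)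
  → ∀ a → Γ ⊩ φ [ a ] ⇒ φ [ zero' ]
descend-to-zero φ ind descend a =
  ⇒I (raa (⇒E (∀E (⇒E ind (∧I (hyp (here refl)) (∀I (⇒I (⇒I
    (⇒E (hyp (there (here refl)))
        (descend (cast (substF-ext {τ = set₀ (S' v0)} (λ { nz → refl ; (ns i) → refl }) φ)
                       (hyp (here refl)))))))))) a)
          (hyp (there (here refl)))))

+-cancelˡ-∀ : ∀ {Γ} → Γ ⊩ ∀' (∀' (∀' (v2 +' v1 ≐ v2 +' v0 ⇒ v1 ≐ v0)))
+-cancelˡ-∀ = ∀I (∀I (∀I (⇒I (cancel-zero (⇒E (descend-to-zero φ ind descend v2) (hyp (here refl)))))))
  where
  φ : Formula
  φ = v0 +' v2 ≐ v0 +' v1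
  ind : ∀ {Δ} → Δ ⊩ indAx (¬' φ)
  ind = ∀E₂ (ax (Ind 2 (v0 +' v2) (v0 +' v1))) v1 v0
  descend : ∀ {Δ} → Δ ⊩ S' v0 +' v2 ≐ S' v0 +' v1 → Δ ⊩ φ
  descend h = S-injective (≐-trans (≐-sym (+-sucˡ v0 v2)) (≐-trans h (+-sucˡ v0 v1)))
  cancel-zero : ∀ {Δ} → Δ ⊩ zero' +' v1 ≐ zero' +' v0 → Δ ⊩ v1 ≐ v0
  cancel-zero h = ≐-trans (≐-sym (+-identityˡ v1)) (≐-trans h (+-identityˡ v0))

+-cancelˡ : ∀ {Γ a b c} → Γ ⊩ c +' a ≐ c +' b → Γ ⊩ a ≐ b
+-cancelˡ {a = a} {b} {c} = ⇒E (∀E₃ +-cancelˡ-∀ c a b)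

+-cancelʳ : ∀ {Γ a b c} → Γ ⊩ a +' c ≐ b +' c → Γ ⊩ a ≐ b
+-cancelʳ {a = a} {b} {c} h = +-cancelˡ (≐-trans (+-comm c a) (≐-trans h (+-comm b c)))

Identity : Term → Term → Set
Identity t s = ∀ {Γ} σ → Γ ⊩ substT σ t ≐ substT σ s

StepsDown : Term → Term → Set
StepsDown t s = ∀ {Γ} σ q p
  → Γ ⊩ substT σ (t ⟨ S' v0 ⟩) +' q ≐ substT σ (s ⟨ S' v0 ⟩) +' p
  → Γ ⊩ substT σ t +' q ≐ substT σ s +' p

steps-down-by-suc : ∀ t s → Identity (t ⟨ S' v0 ⟩) (S' t) → Identity (s ⟨ S' v0 ⟩) (S' s) → StepsDown t s
steps-down-by-suc t s t-suc s-suc σ q p h = S-injective (begin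
  S' (T +' q)             ≈⟨ +-sucˡ T q ⟨
  S' T +' q               ≈⟨ +-congʳ q (t-suc σ) ⟨
  substT σ (t ⟨ S' v0 ⟩) +' q ≈⟨ h ⟩
  substT σ (s ⟨ S' v0 ⟩) +' p ≈⟨ +-congʳ p (s-suc σ) ⟩
  S' U +' p               ≈⟨ +-sucˡ U p ⟩
  S' (U +' p)             ∎)
  where
  open ≐-Reasoning
  T U : Term
  T = substT σ t
  U = substT σ s

-- E(x) :≡ t(x) + s(a) = s(x) + t(a), with x as variable 0 and the point a as variable 1.
descentFormula : Term → Term → Formula
descentFormula t s = shiftT₁ t +' shiftT s ≐ shiftT₁ s +' shiftT t

descent : ∀ t s
  → (∀ {Δ} → Δ ⊩ indAx (¬' (descentFormula t s)))
  → (∀ {Δ} → Δ ⊩ t ⟨ zero' ⟩ ≐ s ⟨ zero' ⟩)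
  → StepsDown t s
  → ∀ {Γ} → Γ ⊩ t ≐ s
descent t s ind base steps = ≐-sym (+-cancelˡ (≐-trans (+-congʳ s (≐-sym base)) at-zero))
  where
  φ : Formula
  φ = descentFormula t s
  at-a : ∀ {Γ} → Γ ⊩ φ [ v0 ]
  at-a = cast (cong₂ _≐_ (cong₂ _+'_ (sym (single-v0-shiftT₁ t)) (sym (single-shiftT v0 s)))
                         (cong₂ _+'_ (sym (single-v0-shiftT₁ s)) (sym (single-shiftT v0 t))))
              (+-comm t s)
  descend : ∀ {Δ} → Δ ⊩ substF (set₀ (S' v0)) φ → Δ ⊩ φ
  descend h = steps (lift (λ i → var (ns i))) (shiftT s) (shiftT t)
    (cast (cong₂ _≐_ (cong₂ _+'_ (set₀-shiftT₁ (S' v0) t) (set₀-shiftT (S' v0) s))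
                     (cong₂ _+'_ (set₀-shiftT₁ (S' v0) s) (set₀-shiftT (S' v0) t)))
          h)
  at-zero : ∀ {Γ} → Γ ⊩ t ⟨ zero' ⟩ +' s ≐ s ⟨ zero' ⟩ +' t
  at-zero = cast (cong₂ _≐_ (cong₂ _+'_ (single-shiftT₁ zero' t) (single-shiftT zero' s))
                            (cong₂ _+'_ (single-shiftT₁ zero' s) (single-shiftT zero' t)))
                 (⇒E (descend-to-zero φ ind descend v0) at-a)

descentInduction : ∀ n t s → I≠+comm (∀ⁿ n (indAx (¬' (descentFormula t s))))
descentInduction n t s = Ind n (shiftT₁ t +' shiftT s) (shiftT₁ s +' shiftT t)

+-assoc-∀ : ∀ {Γ} → Γ ⊩ ∀' (∀' (∀' (v2 +' (v1 +' v0) ≐ (v2 +' v1) +' v0)))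
+-assoc-∀ = ∀I (∀I (∀I (descent t s (∀E₃ (ax (descentInduction 3 t s)) v2 v1 v0) base
  (steps-down-by-suc t s
    (λ σ → ≐-trans (+-congˡ (σ 2) (+-sucʳ (σ 1) (σ 0))) (+-sucʳ (σ 2) (σ 1 +' σ 0)))
    (λ σ → +-sucʳ (σ 2 +' σ 1) (σ 0))))))
  where
  t s : Term
  t = v2 +' (v1 +' v0)
  s = (v2 +' v1) +' v0
  base : ∀ {Γ} → Γ ⊩ v2 +' (v1 +' zero') ≐ (v2 +' v1) +' zero'
  base = ≐-trans (+-congˡ v2 (+-identityʳ v1)) (≐-sym (+-identityʳ (v2 +' v1)))

+-assoc : ∀ {Γ} a b c → Γ ⊩ a +' (b +' c) ≐ (a +' b) +' c
+-assoc = ∀E₃ +-assoc-∀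

+-swapʳ : ∀ {Γ} a b c → Γ ⊩ (a +' b) +' c ≐ (a +' c) +' b
+-swapʳ a b c = begin
  (a +' b) +' c ≈⟨ +-assoc a b c ⟨
  a +' (b +' c) ≈⟨ +-congˡ a (+-comm b c) ⟩
  a +' (c +' b) ≈⟨ +-assoc a c b ⟩
  (a +' c) +' b ∎
  where open ≐-Reasoning

+-interchange : ∀ {Γ} a b c d → Γ ⊩ (a +' b) +' (c +' d) ≐ (a +' c) +' (b +' d)
+-interchange a b c d = begin
  (a +' b) +' (c +' d) ≈⟨ +-assoc (a +' b) c d ⟩
  ((a +' b) +' c) +' d ≈⟨ +-congʳ d (+-swapʳ a b c) ⟩
  ((a +' c) +' b) +' d ≈⟨ +-assoc (a +' c) b d ⟨
  (a +' c) +' (b +' d) ∎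
  where open ≐-Reasoning

steps-down-by-summand : ∀ t s k → Identity (t ⟨ S' v0 ⟩) (t +' k) → Identity (s ⟨ S' v0 ⟩) (s +' k)
  → StepsDown t s
steps-down-by-summand t s k t-suc s-suc σ q p h = +-cancelʳ (begin
  (T +' q) +' K           ≈⟨ +-swapʳ T q K ⟩
  (T +' K) +' q           ≈⟨ +-congʳ q (t-suc σ) ⟨
  substT σ (t ⟨ S' v0 ⟩) +' q ≈⟨ h ⟩
  substT σ (s ⟨ S' v0 ⟩) +' p ≈⟨ +-congʳ p (s-suc σ) ⟩
  (U +' K) +' p           ≈⟨ +-swapʳ U K p ⟩
  (U +' p) +' K           ∎)
  where
  open ≐-Reasoning
  T U K : Term
  T = substT σ t
  U = substT σ s
  K = substT σ k

·-zeroˡ-∀ : ∀ {Γ} → Γ ⊩ ∀' (zero' ·' v0 ≐ zero')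
·-zeroˡ-∀ = ∀I (descent (zero' ·' v0) zero' (∀E (ax (descentInduction 1 (zero' ·' v0) zero')) v0)
  (·-zeroʳ zero')
  (steps-down-by-summand (zero' ·' v0) zero' zero'
    (λ σ → ·-sucʳ zero' (σ 0)) (λ σ → ≐-sym (+-identityʳ zero'))))

·-zeroˡ : ∀ {Γ} a → Γ ⊩ zero' ·' a ≐ zero'
·-zeroˡ = ∀E ·-zeroˡ-∀

·-sucˡ-∀ : ∀ {Γ} → Γ ⊩ ∀' (∀' (S' v1 ·' v0 ≐ v1 ·' v0 +' v0))
·-sucˡ-∀ = ∀I (∀I (descent t s (∀E₂ (ax (descentInduction 2 t s)) v1 v0) base
  (steps-down-by-summand t s (S' v1) (λ σ → ·-sucʳ (S' (σ 1)) (σ 0)) s-suc)))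
  where
  t s : Term
  t = S' v1 ·' v0
  s = v1 ·' v0 +' v0
  base : ∀ {Γ} → Γ ⊩ S' v1 ·' zero' ≐ v1 ·' zero' +' zero'
  base = ≐-trans (·-zeroʳ (S' v1)) (≐-sym (≐-trans (+-identityʳ (v1 ·' zero')) (·-zeroʳ v1)))
  s-suc : Identity (s ⟨ S' v0 ⟩) (s +' S' v1)
  s-suc σ = begin
    y ·' S' x +' S' x     ≈⟨ +-congʳ (S' x) (·-sucʳ y x) ⟩
    (y ·' x +' y) +' S' x ≈⟨ +-sucʳ (y ·' x +' y) x ⟩
    S' ((y ·' x +' y) +' x) ≈⟨ S-cong (+-swapʳ (y ·' x) y x) ⟩
    S' ((y ·' x +' x) +' y) ≈⟨ +-sucʳ (y ·' x +' x) y ⟨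
    (y ·' x +' x) +' S' y ∎
    where
    open ≐-Reasoning
    x y : Term
    x = σ 0
    y = σ 1

·-sucˡ : ∀ {Γ} a b → Γ ⊩ S' a ·' b ≐ a ·' b +' b
·-sucˡ = ∀E₂ ·-sucˡ-∀

·-comm-∀ : ∀ {Γ} → Γ ⊩ ∀' (∀' (v1 ·' v0 ≐ v0 ·' v1))
·-comm-∀ = ∀I (∀I (descent t s (∀E₂ (ax (descentInduction 2 t s)) v1 v0)
  (≐-trans (·-zeroʳ v1) (≐-sym (·-zeroˡ v1)))
  (steps-down-by-summand t s v1 (λ σ → ·-sucʳ (σ 1) (σ 0)) (λ σ → ·-sucˡ (σ 0) (σ 1)))))
  where
  t s : Term
  t = v1 ·' v0
  s = v0 ·' v1

·-distribˡ-∀ : ∀ {Γ} → Γ ⊩ ∀' (∀' (∀' (v2 ·' (v1 +' v0) ≐ v2 ·' v1 +' v2 ·' v0)))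
·-distribˡ-∀ = ∀I (∀I (∀I (descent t s (∀E₃ (ax (descentInduction 3 t s)) v2 v1 v0) base
  (steps-down-by-summand t s v2 t-suc s-suc))))
  where
  t s : Term
  t = v2 ·' (v1 +' v0)
  s = v2 ·' v1 +' v2 ·' v0
  base : ∀ {Γ} → Γ ⊩ v2 ·' (v1 +' zero') ≐ v2 ·' v1 +' v2 ·' zero'
  base = begin
    v2 ·' (v1 +' zero')   ≈⟨ ·-congˡ v2 (+-identityʳ v1) ⟩
    v2 ·' v1              ≈⟨ +-identityʳ (v2 ·' v1) ⟨
    v2 ·' v1 +' zero'     ≈⟨ +-congˡ (v2 ·' v1) (·-zeroʳ v2) ⟨
    v2 ·' v1 +' v2 ·' zero' ∎
    where open ≐-Reasoning
  t-suc : Identity (t ⟨ S' v0 ⟩) (t +' v2)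
  t-suc σ = ≐-trans (·-congˡ (σ 2) (+-sucʳ (σ 1) (σ 0))) (·-sucʳ (σ 2) (σ 1 +' σ 0))
  s-suc : Identity (s ⟨ S' v0 ⟩) (s +' v2)
  s-suc σ = ≐-trans (+-congˡ (σ 2 ·' σ 1) (·-sucʳ (σ 2) (σ 0))) (+-assoc (σ 2 ·' σ 1) (σ 2 ·' σ 0) (σ 2))

·-distribˡ : ∀ {Γ} a b c → Γ ⊩ a ·' (b +' c) ≐ a ·' b +' a ·' c
·-distribˡ = ∀E₃ ·-distribˡ-∀

·-distribʳ-∀ : ∀ {Γ} → Γ ⊩ ∀' (∀' (∀' ((v2 +' v1) ·' v0 ≐ v2 ·' v0 +' v1 ·' v0)))
·-distribʳ-∀ = ∀I (∀I (∀I (descent t s (∀E₃ (ax (descentInduction 3 t s)) v2 v1 v0) base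
  (steps-down-by-summand t s (v2 +' v1) (λ σ → ·-sucʳ (σ 2 +' σ 1) (σ 0)) s-suc))))
  where
  t s : Term
  t = (v2 +' v1) ·' v0
  s = v2 ·' v0 +' v1 ·' v0
  base : ∀ {Γ} → Γ ⊩ (v2 +' v1) ·' zero' ≐ v2 ·' zero' +' v1 ·' zero'
  base = begin
    (v2 +' v1) ·' zero'       ≈⟨ ·-zeroʳ (v2 +' v1) ⟩
    zero'                     ≈⟨ +-identityʳ zero' ⟨
    zero' +' zero'            ≈⟨ +-cong (·-zeroʳ v2) (·-zeroʳ v1) ⟨
    v2 ·' zero' +' v1 ·' zero' ∎
    where open ≐-Reasoning
  s-suc : Identity (s ⟨ S' v0 ⟩) (s +' (v2 +' v1))
  s-suc σ = ≐-trans (+-cong (·-sucʳ (σ 2) (σ 0)) (·-sucʳ (σ 1) (σ 0)))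
                    (+-interchange (σ 2 ·' σ 0) (σ 2) (σ 1 ·' σ 0) (σ 1))

·-assoc-∀ : ∀ {Γ} → Γ ⊩ ∀' (∀' (∀' (v2 ·' (v1 ·' v0) ≐ (v2 ·' v1) ·' v0)))
·-assoc-∀ = ∀I (∀I (∀I (descent t s (∀E₃ (ax (descentInduction 3 t s)) v2 v1 v0) base
  (steps-down-by-summand t s (v2 ·' v1)
    (λ σ → ≐-trans (·-congˡ (σ 2) (·-sucʳ (σ 1) (σ 0))) (·-distribˡ (σ 2) (σ 1 ·' σ 0) (σ 1)))
    (λ σ → ·-sucʳ (σ 2 ·' σ 1) (σ 0))))))
  where
  t s : Term
  t = v2 ·' (v1 ·' v0)
  s = (v2 ·' v1) ·' v0
  base : ∀ {Γ} → Γ ⊩ v2 ·' (v1 ·' zero') ≐ (v2 ·' v1) ·' zero'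
  base = ≐-trans (·-congˡ v2 (·-zeroʳ v1)) (≐-trans (·-zeroʳ v2) (≐-sym (·-zeroʳ (v2 ·' v1))))

lemma3p2 : (I≠+comm ⊢₀ ∀' (∀' (∀' (v2 +' (v1 +' v0) ≐ (v2 +' v1) +' v0))))
    × (I≠+comm ⊢₀ ∀' (∀' (v1 ·' v0 ≐ v0 ·' v1)))
    × (I≠+comm ⊢₀ ∀' (∀' (∀' (v2 ·' (v1 ·' v0) ≐ (v2 ·' v1) ·' v0))))
    × (I≠+comm ⊢₀ ∀' (∀' (∀' (v2 ·' (v1 +' v0) ≐ v2 ·' v1 +' v2 ·' v0))))
    × (I≠+comm ⊢₀ ∀' (∀' (∀' ((v2 +' v1) ·' v0 ≐ v2 ·' v0 +' v1 ·' v0))))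
lemma3p2 = +-assoc-∀ , ·-comm-∀ , ·-assoc-∀ , ·-distribˡ-∀ , ·-distribʳ-∀
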